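{- For every $B\subset\mathbb{N}$ containing at least two elements, there exists a non-self-loop function $S:\mathbb{N}^k\to\mathbb{Z}$ (for some $k$) with multiplicative structure such that $\langle B,S\rangle$ is an $\mathbb{N}$-Induction Model.
   Context: $\mathbb{N}=\{1,2,\dots\}$. $S$ is a self-loop function if $S(x_1,\dots,x_k)\in\{x_1,\dots,x_k\}$ for all inputs, non-self-loop otherwise. $S$ has multiplicative structure if $S(x_1,\dots,x_k)=\sum_{I\subseteq\{1,\dots,k\}}a_I\prod_{j\in I}x_j$ with $a_I\in\mathbb{Z}$ and the coefficient of $x_1x_2\cdots x_k$ nonzero. $\langle B,S\rangle$ is an $\mathbb{N}$-Induction Model if every $G\subseteq\mathbb{N}$ with $B\subseteq G$ and such that $x_1,\dots,x_k\in G$, $S(x_1,\dots,x_k)\in\mathbb{N}$ imply $S(x_1,\dots,x_k)\in G$, satisfies $G=\mathbb{N}$. -}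

module Defs where

open import Data.Nat using (ℕ; zero; suc; _≤_)
open import Data.Integer as ℤ using (ℤ; +_)
open import Data.Bool using (Bool; true; false)
open import Data.Vec using (Vec; []; _∷_; replicate)
open import Data.List using (List; []; _∷_; map; _++_)
open import Data.Product using (Σ; ∃; ∃-syntax; _×_; _,_)
open import Data.Empty using (⊥)
open import Relation.Nullary using (¬_)
open import Relation.Binary.PropositionalEquality using (_≡_; _≢_)
open import Data.Fin using (Fin)
import Data.Vec as V

-- Positive naturals ℕ = {1,2,...} are represented by Agda naturals n with 1 ≤ n.
Pos : ℕ → Set
Pos n = 1 ≤ n

SubsetOfPos : (ℕ → Set) → Set
SubsetOfPos A = ∀ n → A n → Pos n

allSubsets : (k : ℕ) → List (Vec Bool k)
allSubsets zero = [] ∷ []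
allSubsets (suc k) = map (false ∷_) (allSubsets k) ++ map (true ∷_) (allSubsets k)

monomial : ∀ {k} → Vec Bool k → Vec ℕ k → ℤ
monomial [] [] = + 1
monomial (false ∷ I) (x ∷ xs) = monomial I xs
monomial (true ∷ I) (x ∷ xs) = (+ x) ℤ.* monomial I xs

sumℤ : List ℤ → ℤ
sumℤ [] = + 0
sumℤ (z ∷ zs) = z ℤ.+ sumℤ zs

-- The function with multiplicative structure given by coefficients a_I:
-- S(x_1,…,x_k) = Σ_{I ⊆ {1..k}} a_I ∏_{j∈I} x_j
multFun : ∀ {k} → (Vec Bool k → ℤ) → Vec ℕ k → ℤ
multFun {k} a xs = sumℤ (map (λ I → a I ℤ.* monomial I xs) (allSubsets k))

TopCoeffNonzero : ∀ {k} → (Vec Bool k → ℤ) → Set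
TopCoeffNonzero {k} a = a (replicate k true) ≢ + 0

SelfLoop : ∀ {k} → (Vec ℕ k → ℤ) → Set
SelfLoop {k} S = ∀ (xs : Vec ℕ k) → (∀ i → Pos (V.lookup xs i)) →
  ∃[ i ] S xs ≡ + (V.lookup xs i)

NonSelfLoop : ∀ {k} → (Vec ℕ k → ℤ) → Set
NonSelfLoop S = ¬ SelfLoop S

ClosedUnder : ∀ {k} → (Vec ℕ k → ℤ) → (ℕ → Set) → Set
ClosedUnder {k} S G = ∀ (xs : Vec ℕ k) → (∀ i → G (V.lookup xs i)) →
  ∀ m → Pos m → S xs ≡ + m → G m

InductionModel : ∀ {k} → (ℕ → Set) → (Vec ℕ k → ℤ) → Set₁
InductionModel B S = ∀ (G : ℕ → Set) → SubsetOfPos G →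
  (∀ n → B n → G n) → ClosedUnder S G → ∀ n → Pos n → G n

-- With p < q in B, the polynomial
--   S(x, y, z) = x (1 + (p − y)(q − z)) + 2 (y − q) + 1
-- (whose xyz-coefficient is 1) satisfies S(x, q, q) = x + 1 and
-- S(x, p, p) = x − (2(q − p) − 1).  A set G ⊇ B closed under S therefore
-- contains p and is closed under successor, so it contains every n ≥ p;
-- and it is closed under downward steps of the fixed size 2(q − p) − 1 ≥ 1,
-- which reach every positive n from above.  Finally S(q, q, q) = q + 1, so S
-- is not a self-loop function.
module Submission where

open import Defs
open import Data.Nat using (ℕ)
open import Data.Integer using (ℤ)
open import Data.Bool using (Bool)
open import Data.Vec using (Vec)
open import Data.Product using (Σ; ∃; ∃-syntax; _×_; _,_)
open import Relation.Binary.PropositionalEquality using (_≢_)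

open import Data.Nat as ℕ using (suc; zero; _≤_; _<_)
open import Data.Nat.Properties
  using (≤⇒≤″; m+[n∸m]≡n; <-cmp; +-identityʳ; +-suc; +-assoc; ≤-trans; m≤m+n; m≤n+m; m≤m*n; 1+n≢n)
open import Algebra.Definitions.RawMagma ℕ.+-rawMagma using (_,_)
open import Data.Integer using (+_; -_; _+_; _*_; _-_)
open import Data.Integer.Properties using (pos-+; pos-*; +-injective)
open import Data.Integer.Tactic.RingSolver using (solve-∀)
open import Data.Bool using (true; false)
open import Data.Vec using ([]; _∷_; replicate; lookup)
open import Data.Vec.Properties using (lookup-replicate)
open import Data.Vec.Relation.Unary.All using ([]; _∷_)
open import Data.Vec.Relation.Unary.All.Properties using (lookup⁺)
open import Data.Empty using (⊥-elim)
open import Relation.Binary.Definitions using (tri<; tri≈; tri>)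
open import Relation.Binary.PropositionalEquality
  using (_≡_; refl; sym; trans; cong; cong₂; subst; module ≡-Reasoning)

module _ {G : ℕ → Set} where

  closed-above : ∀ {p} → G p → (∀ x → G x → G (suc x)) → ∀ {n} → p ≤ n → G n
  closed-above {p} Gp up {n} p≤n = subst G (m+[n∸m]≡n p≤n) (from-base (n ℕ.∸ p))
    where
    from-base : ∀ k → G (p ℕ.+ k)
    from-base zero    = subst G (sym (+-identityʳ p)) Gp
    from-base (suc k) = subst G (sym (+-suc p k)) (up _ (from-base k))

  closed-below : ∀ r → (∀ m → Pos m → G (m ℕ.+ r) → G m) →
                 ∀ j {m} → Pos m → G (m ℕ.+ j ℕ.* r) → G m
  closed-below r down zero    {m} _  Gm = subst G (+-identityʳ m) Gm
  closed-below r down (suc j) {m} pm G+ =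
    down m pm (closed-below r down j (≤-trans pm (m≤m+n m r))
                 (subst G (sym (+-assoc m r (j ℕ.* r))) G+))

  closed-up-down⇒positive : ∀ {p} s → G p → (∀ x → G x → G (suc x)) →
    (∀ m → Pos m → G (m ℕ.+ suc s) → G m) → ∀ n → Pos n → G n
  closed-up-down⇒positive {p} s Gp up down n pn =
    closed-below (suc s) down p pn (closed-above Gp up p≤n+p*r)
    where
    p≤n+p*r : p ≤ n ℕ.+ p ℕ.* suc s
    p≤n+p*r = ≤-trans (m≤m*n p (suc s)) (m≤n+m (p ℕ.* suc s) n)

stepCoeffs : ℤ → ℤ → Vec Bool 3 → ℤ
stepCoeffs p q (false ∷ false ∷ false ∷ []) = + 1 - + 2 * q
stepCoeffs p q (false ∷ false ∷ true  ∷ []) = + 0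
stepCoeffs p q (false ∷ true  ∷ false ∷ []) = + 2
stepCoeffs p q (false ∷ true  ∷ true  ∷ []) = + 0
stepCoeffs p q (true  ∷ false ∷ false ∷ []) = + 1 + p * q
stepCoeffs p q (true  ∷ false ∷ true  ∷ []) = - p
stepCoeffs p q (true  ∷ true  ∷ false ∷ []) = - q
stepCoeffs p q (true  ∷ true  ∷ true  ∷ []) = + 1

multFun-stepCoeffs : ∀ p q x y z → multFun (stepCoeffs p q) (x ∷ y ∷ z ∷ []) ≡
  + x * (+ 1 + (p - + y) * (q - + z)) + + 2 * (+ y - q) + + 1
multFun-stepCoeffs p q x y z = expand p q (+ x) (+ y) (+ z)
  where
  -- the left-hand side is what multFun unfolds to, summing over allSubsets 3
  expand : ∀ p q x y z →
    (+ 1 - + 2 * q) * + 1 + (+ 0 * (z * + 1) + (+ 2 * (y * + 1) +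
    (+ 0 * (y * (z * + 1)) + ((+ 1 + p * q) * (x * + 1) + (- p * (x * (z * + 1)) +
    (- q * (x * (y * + 1)) + (+ 1 * (x * (y * (z * + 1))) + + 0)))))))
      ≡ x * (+ 1 + (p - y) * (q - z)) + + 2 * (y - q) + + 1
  expand = solve-∀

stepCoeffs-up : ∀ p q x → multFun (stepCoeffs p (+ q)) (x ∷ q ∷ q ∷ []) ≡ + suc x
stepCoeffs-up p q x = begin
  multFun (stepCoeffs p (+ q)) (x ∷ q ∷ q ∷ [])                ≡⟨ multFun-stepCoeffs p (+ q) x q q ⟩
  + x * (+ 1 + (p - + q) * (+ q - + q)) + + 2 * (+ q - + q) + + 1 ≡⟨ at-q p (+ q) (+ x) ⟩
  + 1 + + x                                                      ≡⟨ sym (pos-+ 1 x) ⟩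
  + suc x                                                        ∎
  where
  open ≡-Reasoning
  at-q : ∀ p q x → x * (+ 1 + (p - q) * (q - q)) + + 2 * (q - q) + + 1 ≡ + 1 + x
  at-q = solve-∀

stepCoeffs-down : ∀ p e m →
  multFun (stepCoeffs (+ p) (+ suc (p ℕ.+ e))) (m ℕ.+ suc (2 ℕ.* e) ∷ p ∷ p ∷ []) ≡ + m
stepCoeffs-down p e m = begin
  multFun (stepCoeffs (+ p) (+ suc (p ℕ.+ e))) (m ℕ.+ suc (2 ℕ.* e) ∷ p ∷ p ∷ [])
    ≡⟨ multFun-stepCoeffs (+ p) (+ suc (p ℕ.+ e)) (m ℕ.+ suc (2 ℕ.* e)) p p ⟩
  at-p (+ (m ℕ.+ suc (2 ℕ.* e))) (+ suc (p ℕ.+ e))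
    ≡⟨ cong₂ at-p x≡ q≡ ⟩
  at-p (+ m + (+ 1 + + 2 * + e)) (+ 1 + (+ p + + e))
    ≡⟨ down-identity (+ m) (+ p) (+ e) ⟩
  + m ∎
  where
  open ≡-Reasoning
  at-p : ℤ → ℤ → ℤ
  at-p x q = x * (+ 1 + (+ p - + p) * (q - + p)) + + 2 * (+ p - q) + + 1
  x≡ : + (m ℕ.+ suc (2 ℕ.* e)) ≡ + m + (+ 1 + + 2 * + e)
  x≡ = trans (pos-+ m (suc (2 ℕ.* e)))
             (cong (λ d → + m + d) (trans (pos-+ 1 (2 ℕ.* e)) (cong (λ d → + 1 + d) (pos-* 2 e))))
  q≡ : + suc (p ℕ.+ e) ≡ + 1 + (+ p + + e)
  q≡ = trans (pos-+ 1 (p ℕ.+ e)) (cong (λ d → + 1 + d) (pos-+ p e))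
  down-identity : ∀ m p e →
    (m + (+ 1 + + 2 * e)) * (+ 1 + (p - p) * ((+ 1 + (p + e)) - p)) + + 2 * (p - (+ 1 + (p + e))) + + 1 ≡ m
  down-identity = solve-∀

stepCoeffs-nonSelfLoop : ∀ p q → Pos q → NonSelfLoop (multFun (stepCoeffs p (+ q)))
stepCoeffs-nonSelfLoop p q q-pos selfLoop =
  let i , S≡xᵢ = selfLoop (replicate 3 q) all-pos
  in 1+n≢n (+-injective (begin
    + suc q                                      ≡⟨ sym (stepCoeffs-up p q q) ⟩
    multFun (stepCoeffs p (+ q)) (replicate 3 q) ≡⟨ S≡xᵢ ⟩
    + lookup (replicate 3 q) i                   ≡⟨ cong +_ (lookup-replicate i q) ⟩
    + q                                          ∎))
  where
  open ≡-Reasoning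
  all-pos : ∀ i → Pos (lookup (replicate 3 q) i)
  all-pos i = subst Pos (sym (lookup-replicate i q)) q-pos

stepCoeffs-inductionModel : ∀ {B} p e → B p → B (suc (p ℕ.+ e)) →
  InductionModel B (multFun (stepCoeffs (+ p) (+ suc (p ℕ.+ e))))
stepCoeffs-inductionModel p e Bp Bq G _ B⊆G closed =
  closed-up-down⇒positive (2 ℕ.* e) (B⊆G p Bp) up down
  where
  q = suc (p ℕ.+ e)
  triple : ∀ {a b c} → G a → G b → G c → ∀ i → G (lookup (a ∷ b ∷ c ∷ []) i)
  triple Ga Gb Gc = lookup⁺ {P = G} (Ga ∷ Gb ∷ Gc ∷ [])
  up : ∀ x → G x → G (suc x)
  up x Gx = closed (x ∷ q ∷ q ∷ []) (triple Gx (B⊆G q Bq) (B⊆G q Bq))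
                   (suc x) (ℕ.s≤s ℕ.z≤n) (stepCoeffs-up (+ p) q x)
  down : ∀ m → Pos m → G (m ℕ.+ suc (2 ℕ.* e)) → G m
  down m pm Gx = closed (_ ∷ p ∷ p ∷ []) (triple Gx (B⊆G p Bp) (B⊆G p Bp))
                        m pm (stepCoeffs-down p e m)

<⇒gap : ∀ {B : ℕ → Set} {a b} → B a → B b → a < b → ∃[ p ] ∃[ e ] (B p × B (suc (p ℕ.+ e)))
<⇒gap Ba Bb a<b with ≤⇒≤″ a<b
... | e , refl = _ , e , Ba , Bb

distinct⇒gap : ∀ {B : ℕ → Set} → (∃[ b₁ ] ∃[ b₂ ] (B b₁ × B b₂ × b₁ ≢ b₂)) →
  ∃[ p ] ∃[ e ] (B p × B (suc (p ℕ.+ e)))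
distinct⇒gap (b₁ , b₂ , B₁ , B₂ , b₁≢b₂) with <-cmp b₁ b₂
... | tri< b₁<b₂ _ _ = <⇒gap B₁ B₂ b₁<b₂
... | tri≈ _ b₁≡b₂ _ = ⊥-elim (b₁≢b₂ b₁≡b₂)
... | tri> _ _ b₂<b₁ = <⇒gap B₂ B₁ b₂<b₁

lemma10 : (B : ℕ → Set) → SubsetOfPos B →
    (∃[ b₁ ] ∃[ b₂ ] (B b₁ × B b₂ × b₁ ≢ b₂)) →
    ∃[ k ] Σ (Vec Bool k → ℤ) (λ a →
      TopCoeffNonzero a × NonSelfLoop (multFun a) × InductionModel B (multFun a))
lemma10 B B-pos distinct with distinct⇒gap distinct
... | p , e , Bp , Bq =
  3 , stepCoeffs (+ p) (+ q) , (λ ()) ,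
  stepCoeffs-nonSelfLoop (+ p) q (B-pos q Bq) ,
  stepCoeffs-inductionModel p e Bp Bq
  where q = suc (p ℕ.+ e)
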